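{- Let $T$ be a finite Church-Rosser Thue system over $\Sigma$ and let $u_1,\dots,u_n$ be strings, irreducible modulo $T$, lying in $L$, such that $L=[u_1]_T\cup\dots\cup[u_n]_T$. Let $Q=\max_{(\ell,r)\in T}|\ell|$. Suppose that $x,y,z\in\Sigma^*$ satisfy $xy\to_T z$, where $y$ is unmixed and $|z|\ge Q$. Then $z$ can be factored as $z=x'y'$ where $y'$ is unmixed and $|y'|>|y|-Q$.
   Context: $\Sigma=\{a,b,\overline{a},\overline{b}\}$; $a,b$ are positive letters and $\overline{a},\overline{b}$ negative letters. A string is mixed if it contains both a positive and a negative letter, otherwise unmixed. $\lambda$ is the empty string. $S$ is the Thue system with rules $(a\overline{a},\lambda),(\overline{a}a,\lambda),(a\overline{b},\lambda),(\overline{b}a,\lambda),(b\overline{a},\lambda),(\overline{a}b,\lambda),(b\overline{b},\lambda),(\overline{b}b,\lambda),(a,b),(b,a),(\overline{a},\overline{b}),(\overline{b},\overline{a})$, and $L=[\lambda]_S$, the set of strings with equally many positive as negative letters. For a Thue system $T$, rules are written $(\ell,r)$ with $|\ell|\ge|r|$; $x\leftrightarrow_T y$ if $x=tuv$, $y=twv$ with $(u,w)$ or $(w,u)\in T$; $\overset{*}{\leftrightarrow}_T$ its reflexive-transitive closure; $[x]_T$ the class of $x$; $x\to_T y$ means $x\leftrightarrow_T y$ with $|x|>|y|$ (a single rewriting step); a string is irreducible modulo $T$ if no $\to_T$ step applies to it. $T$ is Church-Rosser if $x\overset{*}{\leftrightarrow}_T y$ implies a common $z$ with $x\overset{*}{\to}_T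 z$, $y\overset{*}{\to}_T z$. -}

module Defs where

open import Data.Nat using (ℕ; _≤_; _<_; _⊔_)
open import Data.List using (List; []; _∷_; _++_; length; map; foldr)
open import Data.List.Membership.Propositional using (_∈_)
open import Data.List.Relation.Unary.Any using (Any)
open import Data.Product using (_×_; _,_; ∃; ∃-syntax; proj₁)
open import Data.Sum using (_⊎_)
open import Relation.Nullary using (¬_)
open import Relation.Binary.PropositionalEquality using (_≡_)
open import Relation.Binary.Construct.Closure.ReflexiveTransitive using (Star)

data Letter : Set where
  a b a̅ b̅ : Letter

Str : Set
Str = List Letter

data Positive : Letter → Set where
  pos-a : Positive a
  pos-b : Positive b

data Negative : Letter → Set where
  neg-a : Negative a̅
  neg-b : Negative b̅

Mixed : Str → Set
Mixed w = Any Positive w × Any Negative w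

Unmixed : Str → Set
Unmixed w = ¬ Mixed w

Rule : Set
Rule = Str × Str

ThueSystem : Set
ThueSystem = List Rule

WellOriented : ThueSystem → Set
WellOriented T = ∀ {l r} → (l , r) ∈ T → length r ≤ length l

_⊢_↔_ : ThueSystem → Str → Str → Set
T ⊢ x ↔ y = ∃[ t ] ∃[ u ] ∃[ v ] ∃[ w ]
  ((x ≡ t ++ u ++ v) × (y ≡ t ++ w ++ v) × (((u , w) ∈ T) ⊎ ((w , u) ∈ T)))

_⊢_↔*_ : ThueSystem → Str → Str → Set
T ⊢ x ↔* y = Star (T ⊢_↔_) x y

_⊢_⟶_ : ThueSystem → Str → Str → Set
T ⊢ x ⟶ y = (T ⊢ x ↔ y) × (length y < length x)

_⊢_⟶*_ : ThueSystem → Str → Str → Set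
T ⊢ x ⟶* y = Star (T ⊢_⟶_) x y

Class : ThueSystem → Str → Str → Set
Class T x y = T ⊢ x ↔* y

Irreducible : ThueSystem → Str → Set
Irreducible T x = ¬ (∃[ y ] (T ⊢ x ⟶ y))

ChurchRosser : ThueSystem → Set
ChurchRosser T = ∀ x y → T ⊢ x ↔* y →
  ∃[ z ] ((T ⊢ x ⟶* z) × (T ⊢ y ⟶* z))

S : ThueSystem
S = (a ∷ a̅ ∷ [] , []) ∷ (a̅ ∷ a ∷ [] , []) ∷ (a ∷ b̅ ∷ [] , []) ∷ (b̅ ∷ a ∷ [] , [])
  ∷ (b ∷ a̅ ∷ [] , []) ∷ (a̅ ∷ b ∷ [] , []) ∷ (b ∷ b̅ ∷ [] , []) ∷ (b̅ ∷ b ∷ [] , [])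
  ∷ (a ∷ [] , b ∷ []) ∷ (b ∷ [] , a ∷ []) ∷ (a̅ ∷ [] , b̅ ∷ []) ∷ (b̅ ∷ [] , a̅ ∷ [])
  ∷ []

L : Str → Set
L w = Class S [] w

maxLhs : ThueSystem → ℕ
maxLhs T = foldr _⊔_ 0 (map (λ rule → length (proj₁ rule)) T)

-- Let the weight of a string be its number of positive minus its number of negative letters,
-- so that L is exactly the set of strings of weight 0. Since L is a union of T-classes, every rule
-- (ℓ , r) of T preserves the weight: prefix ℓ with a string p of weight −weight ℓ, then p ℓ ∈ L,
-- hence p r ∈ L. A rule with |r| < |ℓ| and weight ℓ = weight r forces ℓ to be mixed, because an
-- unmixed string has weight of absolute value its length. So the redex ℓ of xy → z is not an infix
-- of the unmixed y: either y survives unchanged as a suffix of z, or ℓ covers a proper prefix s of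
-- y, and then the rest v of y is an unmixed suffix of z with |y| = |s| + |v| < Q + |v|.
module Submission where

open import Defs
open import Data.Nat using (ℕ; _≤_; _<_; _+_; zero; suc; s≤s; z≤n)
import Data.Nat.Properties as ℕ
open import Data.Integer using (ℤ; +_; -[1+_]; -_; ∣_∣) renaming (_+_ to _⊕_)
import Data.Integer.Properties as ℤ
open import Algebra.Bundles using (AbelianGroup)
open import Algebra.Properties.Group (AbelianGroup.group ℤ.+-0-abelianGroup) using (∙-cancelˡ)
open import Data.Fin using (Fin)
open import Data.List using (List; []; _∷_; length; _++_; replicate)
open import Data.List.Properties using (++-assoc; ++-identityʳ; length-++; ∷-injective)
open import Data.List.Relation.Unary.All using ([]; _∷_; lookup)
open import Data.List.Relation.Unary.Any using (Any; here; there; any?)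
open import Data.List.Relation.Unary.Any.Properties using (++⁺ˡ; ++⁺ʳ)
open import Data.List.Membership.Propositional using (_∈_)
open import Data.Product using (_×_; ∃-syntax; _,_; proj₁; proj₂)
open import Data.Sum using (_⊎_; inj₁; inj₂)
open import Data.Empty using (⊥-elim)
open import Relation.Nullary using (¬_; Dec; yes; no)
open import Relation.Nullary.Decidable using (_×-dec_)
open import Relation.Binary.PropositionalEquality
open import Relation.Binary.Construct.Closure.ReflexiveTransitive using (ε; _◅_; _◅◅_; gmap; reverse)

++-≡-++ : ∀ {A : Set} (x y u v : List A) → x ++ y ≡ u ++ v →
          (∃[ m ] v ≡ m ++ y) ⊎ (∃[ s ] (y ≡ s ++ v × x ++ s ≡ u))
++-≡-++ []      y u       v eq = inj₂ (u , eq , refl)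
++-≡-++ (c ∷ x) y []      v eq = inj₁ (c ∷ x , sym eq)
++-≡-++ (c ∷ x) y (_ ∷ u) v eq with ∷-injective eq
... | refl , eq′ with ++-≡-++ x y u v eq′
...   | inj₁ right            = inj₁ right
...   | inj₂ (s , y≡ , x++s≡) = inj₂ (s , y≡ , cong (c ∷_) x++s≡)

-- Where an infix ℓ of x ++ y = t ++ ℓ ++ v lies relative to y.
data InfixPosition {A : Set} (y ℓ v : List A) : Set where
  before : ∀ m → v ≡ m ++ y → InfixPosition y ℓ v
  across : ∀ s → y ≡ s ++ v → length s < length ℓ → InfixPosition y ℓ v
  within : ∀ s v′ → y ≡ s ++ ℓ ++ v′ → InfixPosition y ℓ v

infixPosition : ∀ {A : Set} (x y t ℓ v : List A) → x ++ y ≡ t ++ ℓ ++ v → InfixPosition y ℓ v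
infixPosition x y t ℓ v eq with ++-≡-++ x y t (ℓ ++ v) eq
... | inj₂ (s , y≡ , _) = within s v y≡
... | inj₁ (m , ℓv≡) with ++-≡-++ m y ℓ v (sym ℓv≡)
...   | inj₁ (m′ , v≡)              = before m′ v≡
...   | inj₂ (s , y≡ , refl) with m
...     | []    = within [] v y≡
...     | c ∷ m″ = across s y≡ (s≤s (ℕ.≤-trans (ℕ.m≤n+m (length s) (length m″))
                                               (ℕ.≤-reflexive (sym (length-++ m″)))))

letterWeight : Letter → ℤ
letterWeight a  = + 1
letterWeight b  = + 1
letterWeight a̅ = -[1+ 0 ]
letterWeight b̅ = -[1+ 0 ]

weight : Str → ℤ
weight []      = + 0
weight (c ∷ w) = letterWeight c ⊕ weight w

weight-++ : ∀ x y → weight (x ++ y) ≡ weight x ⊕ weight y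
weight-++ []      y = sym (ℤ.+-identityˡ (weight y))
weight-++ (c ∷ x) y = trans (cong (letterWeight c ⊕_) (weight-++ x y))
                            (sym (ℤ.+-assoc (letterWeight c) (weight x) (weight y)))

∣weight∣≤length : ∀ w → ∣ weight w ∣ ≤ length w
∣weight∣≤length []      = z≤n
∣weight∣≤length (c ∷ w) = ℕ.≤-trans (ℤ.∣i+j∣≤∣i∣+∣j∣ (letterWeight c) (weight w))
                                    (subst (_≤ suc (length w)) (sym (cong (_+ ∣ weight w ∣) (∣letterWeight∣≡1 c)))
                                           (s≤s (∣weight∣≤length w)))
  where
  ∣letterWeight∣≡1 : ∀ c → ∣ letterWeight c ∣ ≡ 1
  ∣letterWeight∣≡1 a  = refl
  ∣letterWeight∣≡1 b  = refl
  ∣letterWeight∣≡1 a̅ = refl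
  ∣letterWeight∣≡1 b̅ = refl

weight-¬negative : ∀ w → ¬ Any Negative w → weight w ≡ + length w
weight-¬negative []       _  = refl
weight-¬negative (a ∷ w)  ¬n = cong (+ 1 ⊕_) (weight-¬negative w (λ n → ¬n (there n)))
weight-¬negative (b ∷ w)  ¬n = cong (+ 1 ⊕_) (weight-¬negative w (λ n → ¬n (there n)))
weight-¬negative (a̅ ∷ w) ¬n = ⊥-elim (¬n (here neg-a))
weight-¬negative (b̅ ∷ w) ¬n = ⊥-elim (¬n (here neg-b))

-1-n≡-[1+n] : ∀ n → -[1+ 0 ] ⊕ - + n ≡ - + suc n
-1-n≡-[1+n] zero    = refl
-1-n≡-[1+n] (suc n) = refl

weight-¬positive : ∀ w → ¬ Any Positive w → weight w ≡ - + length w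
weight-¬positive []       _  = refl
weight-¬positive (a ∷ w)  ¬p = ⊥-elim (¬p (here pos-a))
weight-¬positive (b ∷ w)  ¬p = ⊥-elim (¬p (here pos-b))
weight-¬positive (a̅ ∷ w) ¬p = trans (cong (-[1+ 0 ] ⊕_) (weight-¬positive w (λ p → ¬p (there p))))
                                     (-1-n≡-[1+n] (length w))
weight-¬positive (b̅ ∷ w) ¬p = trans (cong (-[1+ 0 ] ⊕_) (weight-¬positive w (λ p → ¬p (there p))))
                                     (-1-n≡-[1+n] (length w))

positive? : ∀ c → Dec (Positive c)
positive? a  = yes pos-a
positive? b  = yes pos-b
positive? a̅ = no λ ()
positive? b̅ = no λ ()

negative? : ∀ c → Dec (Negative c)
negative? a  = no λ ()
negative? b  = no λ ()
negative? a̅ = yes neg-a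
negative? b̅ = yes neg-b

mixed? : ∀ w → Dec (Mixed w)
mixed? w = any? positive? w ×-dec any? negative? w

Unmixed⇒∣weight∣≡length : ∀ {w} → Unmixed w → ∣ weight w ∣ ≡ length w
Unmixed⇒∣weight∣≡length {w} unmixed with any? positive? w
... | yes p = cong ∣_∣ (weight-¬negative w (λ n → unmixed (p , n)))
... | no ¬p = trans (cong ∣_∣ (weight-¬positive w ¬p)) (ℤ.∣-i∣≡∣i∣ (+ length w))

shorter-of-equal-weight⇒Mixed : ∀ {ℓ r} → weight ℓ ≡ weight r → length r < length ℓ → Mixed ℓ
shorter-of-equal-weight⇒Mixed {ℓ} {r} same shorter with mixed? ℓ
... | yes mixed = mixed
... | no unmixed = ⊥-elim (ℕ.<-irrefl (Unmixed⇒∣weight∣≡length unmixed)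
                            (ℕ.≤-<-trans (subst (_≤ length r) (cong ∣_∣ (sym same)) (∣weight∣≤length r)) shorter))

Mixed-infix : ∀ s {ℓ} v → Mixed ℓ → Mixed (s ++ ℓ ++ v)
Mixed-infix s v (p , n) = ++⁺ʳ s (++⁺ˡ p) , ++⁺ʳ s (++⁺ˡ n)

Unmixed-suffix : ∀ s {v} → Unmixed (s ++ v) → Unmixed v
Unmixed-suffix s unmixed (p , n) = unmixed (++⁺ʳ s p , ++⁺ʳ s n)

↔-sym : ∀ {T x y} → T ⊢ x ↔ y → T ⊢ y ↔ x
↔-sym (t , u , v , w , x≡ , y≡ , inj₁ rule) = t , w , v , u , y≡ , x≡ , inj₂ rule
↔-sym (t , u , v , w , x≡ , y≡ , inj₂ rule) = t , w , v , u , y≡ , x≡ , inj₁ rule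

↔-++ˡ : ∀ {T} p {x y} → T ⊢ x ↔ y → T ⊢ (p ++ x) ↔ (p ++ y)
↔-++ˡ p (t , u , v , w , x≡ , y≡ , rule) =
  p ++ t , u , v , w , trans (cong (p ++_) x≡) (sym (++-assoc p t _)) ,
  trans (cong (p ++_) y≡) (sym (++-assoc p t _)) , rule

rule-↔ : ∀ {T u w} → (u , w) ∈ T → ∀ v → T ⊢ (u ++ v) ↔ (w ++ v)
rule-↔ {u = u} {w} rule v = [] , u , v , w , refl , refl , inj₁ rule

WeightPreserving : ThueSystem → Set
WeightPreserving T = ∀ {ℓ r} → (ℓ , r) ∈ T → weight ℓ ≡ weight r

↔-weight : ∀ {T} → WeightPreserving T → ∀ {x y} → T ⊢ x ↔ y → weight x ≡ weight y
↔-weight {T} preserving (t , u , v , w , refl , refl , rule) = begin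
  weight (t ++ u ++ v)             ≡⟨ weight-++ t (u ++ v) ⟩
  weight t ⊕ weight (u ++ v)       ≡⟨ cong (weight t ⊕_) (weight-++ u v) ⟩
  weight t ⊕ (weight u ⊕ weight v) ≡⟨ cong (λ k → weight t ⊕ (k ⊕ weight v)) (rule-weight rule) ⟩
  weight t ⊕ (weight w ⊕ weight v) ≡⟨ cong (weight t ⊕_) (weight-++ w v) ⟨
  weight t ⊕ weight (w ++ v)       ≡⟨ weight-++ t (w ++ v) ⟨
  weight (t ++ w ++ v)             ∎
  where
  open ≡-Reasoning
  rule-weight : ((u , w) ∈ T) ⊎ ((w , u) ∈ T) → weight u ≡ weight w
  rule-weight (inj₁ rule) = preserving rule
  rule-weight (inj₂ rule) = sym (preserving rule)

↔*-weight : ∀ {T} → WeightPreserving T → ∀ {x y} → T ⊢ x ↔* y → weight x ≡ weight y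
↔*-weight preserving ε          = refl
↔*-weight preserving (s ◅ ss) = trans (↔-weight preserving s) (↔*-weight preserving ss)

S-weightPreserving : WeightPreserving S
S-weightPreserving = lookup {P = λ rule → weight (proj₁ rule) ≡ weight (proj₂ rule)}
  (refl ∷ refl ∷ refl ∷ refl ∷ refl ∷ refl ∷ refl ∷ refl ∷ refl ∷ refl ∷ refl ∷ refl ∷ [])

aa̅∈S : (a ∷ a̅ ∷ [] , []) ∈ S
aa̅∈S = here refl

a̅a∈S : (a̅ ∷ a ∷ [] , []) ∈ S
a̅a∈S = there (here refl)

b→a∈S : (b ∷ [] , a ∷ []) ∈ S
b→a∈S = there (there (there (there (there (there (there (there (there (here refl)))))))))

b̅→a̅∈S : (b̅ ∷ [] , a̅ ∷ []) ∈ S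
b̅→a̅∈S = there (there (there (there (there (there (there (there (there (there (there (here refl)))))))))))

normalForm : ℤ → Str
normalForm (+ n)     = replicate n a
normalForm -[1+ n ] = replicate (suc n) a̅

weight-normalForm : ∀ k → weight (normalForm k) ≡ k
weight-normalForm (+ zero)       = refl
weight-normalForm (+ suc n)      = cong (+ 1 ⊕_) (weight-normalForm (+ n))
weight-normalForm -[1+ zero ]   = refl
weight-normalForm -[1+ suc n ]  = cong (-[1+ 0 ] ⊕_) (weight-normalForm -[1+ n ])

a∷-normalForm : ∀ k → S ⊢ (a ∷ normalForm k) ↔* normalForm (+ 1 ⊕ k)
a∷-normalForm (+ n)          = ε
a∷-normalForm -[1+ zero ]   = rule-↔ aa̅∈S [] ◅ ε
a∷-normalForm -[1+ suc n ]  = rule-↔ aa̅∈S (replicate (suc n) a̅) ◅ ε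

a̅∷-normalForm : ∀ k → S ⊢ (a̅ ∷ normalForm k) ↔* normalForm (-[1+ 0 ] ⊕ k)
a̅∷-normalForm (+ zero)    = ε
a̅∷-normalForm (+ suc n)   = rule-↔ a̅a∈S (replicate n a) ◅ ε
a̅∷-normalForm -[1+ n ]    = ε

∷-normalForm : ∀ c k → S ⊢ (c ∷ normalForm k) ↔* normalForm (letterWeight c ⊕ k)
∷-normalForm a  k = a∷-normalForm k
∷-normalForm b  k = rule-↔ b→a∈S (normalForm k) ◅ a∷-normalForm k
∷-normalForm a̅ k = a̅∷-normalForm k
∷-normalForm b̅ k = rule-↔ b̅→a̅∈S (normalForm k) ◅ a̅∷-normalForm k

↔*-normalForm : ∀ w → S ⊢ w ↔* normalForm (weight w)
↔*-normalForm []      = ε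
↔*-normalForm (c ∷ w) = gmap (c ∷_) (↔-++ˡ (c ∷ [])) (↔*-normalForm w) ◅◅ ∷-normalForm c (weight w)

L⇒weight≡0 : ∀ {w} → L w → weight w ≡ + 0
L⇒weight≡0 inL = sym (↔*-weight S-weightPreserving inL)

weight≡0⇒L : ∀ {w} → weight w ≡ + 0 → L w
weight≡0⇒L {w} balanced =
  reverse ↔-sym (subst (λ k → S ⊢ w ↔* normalForm k) balanced (↔*-normalForm w))

L-closed⇒weightPreserving : ∀ {T} → (∀ {x y} → L x → T ⊢ x ↔ y → L y) → WeightPreserving T
L-closed⇒weightPreserving closed {ℓ} {r} rule = ∙-cancelˡ (weight p) (weight ℓ) (weight r) (begin
  weight p ⊕ weight ℓ ≡⟨ weight-++ p ℓ ⟨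
  weight (p ++ ℓ)     ≡⟨ pℓ-balanced ⟩
  + 0                 ≡⟨ L⇒weight≡0 (closed (weight≡0⇒L pℓ-balanced) step) ⟨
  weight (p ++ r)     ≡⟨ weight-++ p r ⟩
  weight p ⊕ weight r ∎)
  where
  open ≡-Reasoning
  p : Str
  p = normalForm (- weight ℓ)
  pℓ-balanced : weight (p ++ ℓ) ≡ + 0
  pℓ-balanced = trans (weight-++ p ℓ)
                (trans (cong (_⊕ weight ℓ) (weight-normalForm (- weight ℓ))) (ℤ.+-inverseˡ (weight ℓ)))
  step : _ ⊢ (p ++ ℓ) ↔ (p ++ r)
  step = p , ℓ , [] , r , cong (p ++_) (sym (++-identityʳ ℓ)) , cong (p ++_) (sym (++-identityʳ r)) , inj₁ rule

data Redex (T : ThueSystem) (x z : Str) : Set where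
  redex : ∀ t {ℓ r} v → (ℓ , r) ∈ T → length r < length ℓ →
          x ≡ t ++ ℓ ++ v → z ≡ t ++ r ++ v → Redex T x z

length-infix : ∀ {A : Set} (t w v : List A) → length (t ++ w ++ v) ≡ length t + (length w + length v)
length-infix t w v = trans (length-++ t) (cong (_+_ (length t)) (length-++ w))

infix-shorter : ∀ {A : Set} (t : List A) {w u} v → length (t ++ w ++ v) < length (t ++ u ++ v) → length w < length u
infix-shorter t {w} {u} v shorter = ℕ.+-cancelʳ-< (length v) (length w) (length u)
  (ℕ.+-cancelˡ-< (length t) _ _ (subst₂ _<_ (length-infix t w v) (length-infix t u v) shorter))

⟶⇒Redex : ∀ {T x z} → WellOriented T → T ⊢ x ⟶ z → Redex T x z
⟶⇒Redex {T} oriented ((t , u , v , w , refl , refl , rule) , shrinks) =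
  redex t v (left-to-right rule) shorter refl refl
  where
  shorter : length w < length u
  shorter = infix-shorter t v shrinks
  left-to-right : ((u , w) ∈ T) ⊎ ((w , u) ∈ T) → (u , w) ∈ T
  left-to-right (inj₁ u→w) = u→w
  left-to-right (inj₂ w→u) = ⊥-elim (ℕ.<⇒≱ shorter (oriented w→u))

length-lhs≤maxLhs : ∀ {T ℓ r} → (ℓ , r) ∈ T → length ℓ ≤ maxLhs T
length-lhs≤maxLhs {(ℓ , _) ∷ _}  (here refl) = ℕ.m≤m⊔n (length ℓ) _
length-lhs≤maxLhs {(ℓ′ , _) ∷ _} (there rule) = ℕ.≤-trans (length-lhs≤maxLhs rule) (ℕ.m≤n⊔m (length ℓ′) _)

Mixed⇒1≤length : ∀ {w} → Mixed w → 1 ≤ length w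
Mixed⇒1≤length (here _  , _) = s≤s z≤n
Mixed⇒1≤length (there _ , _) = s≤s z≤n

unmixed-suffix-after-replacing : ∀ {y ℓ v Q} t r → InfixPosition y ℓ v → Mixed ℓ → length ℓ ≤ Q → Unmixed y →
  ∃[ x′ ] ∃[ y′ ] ((t ++ r ++ v ≡ x′ ++ y′) × Unmixed y′ × (length y + 1 ≤ length y′ + Q))
unmixed-suffix-after-replacing {y} t r (before m refl) mixed ℓ≤Q unmixed-y =
  t ++ r ++ m , y , trans (cong (t ++_) (sym (++-assoc r m y))) (sym (++-assoc t (r ++ m) y)) ,
  unmixed-y , ℕ.+-monoʳ-≤ (length y) (ℕ.≤-trans (Mixed⇒1≤length mixed) ℓ≤Q)
unmixed-suffix-after-replacing {v = v} {Q} t r (across s refl s<ℓ) _ ℓ≤Q unmixed-y =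
  t ++ r , v , sym (++-assoc t r v) , Unmixed-suffix s unmixed-y , (begin
    length (s ++ v) + 1       ≡⟨ cong (_+ 1) (length-++ s) ⟩
    length s + length v + 1   ≡⟨ cong (_+ 1) (ℕ.+-comm (length s) (length v)) ⟩
    length v + length s + 1   ≡⟨ ℕ.+-assoc (length v) (length s) 1 ⟩
    length v + (length s + 1) ≤⟨ ℕ.+-monoʳ-≤ (length v) (subst (_≤ Q) (ℕ.+-comm 1 (length s)) (ℕ.≤-trans s<ℓ ℓ≤Q)) ⟩
    length v + Q              ∎)
  where open ℕ.≤-Reasoning
unmixed-suffix-after-replacing t r (within s v′ refl) mixed _ unmixed-y =
  ⊥-elim (unmixed-y (Mixed-infix s v′ mixed))

unmixed-suffix-of-⟶ : ∀ {T} → WellOriented T → WeightPreserving T → ∀ {x y z} →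
  T ⊢ (x ++ y) ⟶ z → Unmixed y →
  ∃[ x′ ] ∃[ y′ ] ((z ≡ x′ ++ y′) × Unmixed y′ × (length y + 1 ≤ length y′ + maxLhs T))
unmixed-suffix-of-⟶ oriented preserving {x} {y} step unmixed-y with ⟶⇒Redex oriented step
... | redex t {ℓ} {r} v rule shorter xy≡ refl =
  unmixed-suffix-after-replacing t r (infixPosition x y t ℓ v xy≡)
    (shorter-of-equal-weight⇒Mixed {r = r} (preserving rule) shorter) (length-lhs≤maxLhs rule) unmixed-y

mainTheorem7 : (T : ThueSystem) → WellOriented T → ChurchRosser T →
    (n : ℕ) (u : Fin n → Str) →
    (∀ i → Irreducible T (u i)) → (∀ i → L (u i)) →
    (∀ w → (L w → ∃[ i ] Class T (u i) w) × (∀ i → Class T (u i) w → L w)) →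
    (x y z : Str) → T ⊢ (x ++ y) ⟶ z → Unmixed y → maxLhs T ≤ length z →
    ∃[ x′ ] ∃[ y′ ] ((z ≡ x′ ++ y′) × Unmixed y′ × (length y + 1 ≤ length y′ + maxLhs T))
mainTheorem7 T oriented _ n u _ _ classes x y z step unmixed-y _ =
  unmixed-suffix-of-⟶ oriented (L-closed⇒weightPreserving L-closed) step unmixed-y
  where
  L-closed : ∀ {w w′} → L w → T ⊢ w ↔ w′ → L w′
  L-closed {w} {w′} w∈L w↔w′ with proj₁ (classes w) w∈L
  ... | i , uᵢ↔*w = proj₂ (classes w′) i (uᵢ↔*w ◅◅ w↔w′ ◅ ε)
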